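{- For a positive integer $q$, say that property $\mathcal{P}(q)$ holds if: for every path $P$ whose vertex set is partitioned into $m$ subsets $V_1,\ldots,V_m$ each of size at least $q-1$, there exist pairwise disjoint $q$-stable sets $S_1,\ldots,S_q$ of $P$ such that $S_1\cup\cdots\cup S_q$ contains all vertices of $P$ except exactly $q-1$ vertices of each $V_j$, the sizes $|S_1|,\ldots,|S_q|$ pairwise differ by at most one, and $$|S_i\cap V_j|\ \ge\ \left\lfloor\frac{|V_j|+1}{q}\right\rfloor-1\qquad\text{for all } i\in[q],\ j\in[m].$$ If $\mathcal{P}(q')$ and $\mathcal{P}(q'')$ hold for positive integers $q',q''$, then $\mathcal{P}(q'q'')$ holds.
   Context: In a graph, a set of vertices is $q$-stable if no two of its vertices are at distance less than $q$ (distance measured as the number of edges of a shortest path). In particular, $2$-stable sets are exactly independent sets. -}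

module Defs where

open import Data.Nat using (ℕ; zero; suc; _+_; _*_; _∸_; _≤_; NonZero; ∣_-_∣)
open import Data.Nat.DivMod using (_/_)
open import Data.Fin using (Fin; toℕ; _≟_)
open import Data.Fin.Subset using (Subset; _∈_; _∉_; _∩_; ∁; ⋃; ∣_∣)
open import Data.Vec using (tabulate)
import Data.List as List
open import Data.Product using (Σ; _×_)
open import Relation.Nullary using (¬_)
open import Relation.Nullary.Decidable using (⌊_⌋)
open import Relation.Binary.PropositionalEquality using (_≡_)

-- The path P_n has vertex set Fin n, with vertex v adjacent to v+1.
-- Its graph distance between u and v is |u - v|.
pathDist : {n : ℕ} → Fin n → Fin n → ℕ
pathDist u v = ∣ toℕ u - toℕ v ∣

IsStable : (q : ℕ) {n : ℕ} → Subset n → Set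
IsStable q S = ∀ u v → u ∈ S → v ∈ S → ¬ (u ≡ v) → q ≤ pathDist u v

-- A partition of the vertex set Fin n into m parts V_1..V_m is given by
-- the map c : Fin n → Fin m sending each vertex to the index of its part.
part : {n m : ℕ} → (Fin n → Fin m) → Fin m → Subset n
part c j = tabulate (λ v → ⌊ c v ≟ j ⌋)

Prop : (q : ℕ) → .{{NonZero q}} → Set
Prop q = ∀ (n m : ℕ) (c : Fin n → Fin m) →
  (∀ j → q ∸ 1 ≤ ∣ part c j ∣) →
  Σ (Fin q → Subset n) λ S →
    (∀ i k → ¬ (i ≡ k) → ∀ v → v ∈ S i → v ∉ S k)
    × (∀ i → IsStable q (S i))
    × (∀ j → ∣ part c j ∩ ∁ (⋃ (List.tabulate S)) ∣ ≡ q ∸ 1)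
    × (∀ i k → ∣ S i ∣ ≤ suc ∣ S k ∣)
    × (∀ i j → ((∣ part c j ∣ + 1) / q) ∸ 1 ≤ ∣ S i ∩ part c j ∣)

module Submission where

-- Apply P(q₂) to the whole path to get classes T₁ … T_{q₂}.  The vertices
-- of one class T_b, read from left to right, form a shorter path P_{|T_b|}
-- whose parts are the traces T_b ∩ V_j; apply P(q₁) to it to get classes
-- R_{b,1} … R_{b,q₁}, and map them back to the original path.  The q₁ q₂
-- sets S_{a,b} obtained this way are the required classes:
--  * consecutive vertices of T_b are q₂ apart, so a q₁-stable set of the
--    shorter path lands on a (q₁ q₂)-stable set of P;
--  * each V_j loses q₂ - 1 vertices outside the T_b and q₁ - 1 more inside
--    every T_b, i.e. (q₂ - 1) + q₂ (q₁ - 1) = q₁ q₂ - 1 vertices in total;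
--  * the sizes |T_b| differ by at most one and determine the sums
--    ∑_a |R_{b,a}|, which forces all |S_{a,b}| to differ by at most one;
--  * the lower bounds compose through ⌊⌊x/q₂⌋/q₁⌋ = ⌊x/(q₁ q₂)⌋.

open import Defs
open import Data.Nat using (ℕ; zero; suc; _+_; _*_; _∸_; _≤_; z≤n; s≤s; s≤s⁻¹; _≤?_; NonZero)
open import Data.Nat.Properties
open import Data.Nat.DivMod using (_/_; m/n/o≡m/[n*o]; /-monoˡ-≤; /-congʳ; m*n/n≡m)
open import Data.Bool using (Bool; true; false; _∧_)
open import Data.Bool.Properties using (∧-identityʳ; ∧-zeroʳ)
open import Data.Fin as Fin using (Fin; zero; suc; toℕ; _↑ˡ_; _↑ʳ_; combine; remQuot; punchIn)
open import Data.Fin.Properties using (remQuot-combine; combine-remQuot) renaming (suc-injective to Fin-suc-injective)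
open import Data.Fin.Subset using (Subset; _∈_; _∉_; _∩_; _∪_; ∁; ⋃; ∣_∣; ⊤)
open import Data.Fin.Subset.Properties using (∩-comm; ∩-identityʳ; ∩-zeroʳ; ∣⊥∣≡0; ∣⊤∣≡n; x∈p∪q⁻; ∉⊥)
open import Data.Vec using ([]; _∷_; here; there; tabulate)
import Data.List as List
open import Data.Product using (Σ; _×_; _,_; proj₁; proj₂; uncurry)
open import Data.Sum using (inj₁; inj₂)
open import Data.Empty using (⊥-elim)
open import Function using (_∘_)
open import Relation.Nullary using (¬_; yes; no)
open import Relation.Nullary.Decidable using (⌊_⌋)
open import Relation.Binary.PropositionalEquality
open import Algebra.Properties.CommutativeMonoid.Sum +-0-commutativeMonoid
  using (sum; sum-syntax; sum-cong-≗; ∑-distrib-+; ∑-comm; sum-remove)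

bit : Bool → ℕ
bit true  = 1
bit false = 0

sum-const : ∀ k c → ∑[ i < k ] c ≡ k * c
sum-const zero    c = refl
sum-const (suc k) c = cong (c +_) (sum-const k c)

sum-mono : ∀ {k} {f g : Fin k → ℕ} → (∀ i → f i ≤ g i) → sum f ≤ sum g
sum-mono {zero}  le = z≤n
sum-mono {suc k} le = +-mono-≤ (le zero) (sum-mono (le ∘ suc))

sum-++ : ∀ k l (f : Fin (k + l) → ℕ) →
  sum f ≡ ∑[ i < k ] f (i ↑ˡ l) + ∑[ i < l ] f (k ↑ʳ i)
sum-++ zero    l f = refl
sum-++ (suc k) l f = trans (cong (f zero +_) (sum-++ k l (f ∘ suc))) (sym (+-assoc (f zero) _ _))

sum-combine : ∀ k l (f : Fin (k * l) → ℕ) → sum f ≡ ∑[ a < k ] ∑[ b < l ] f (combine a b)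
sum-combine zero    l f = refl
sum-combine (suc k) l f =
  trans (sum-++ l (k * l) f) (cong (∑[ b < l ] f (b ↑ˡ k * l) +_) (sum-combine k l (f ∘ (l ↑ʳ_))))

sum-remQuot : ∀ k l (h : Fin k → Fin l → ℕ) →
  ∑[ i < k * l ] uncurry h (remQuot l i) ≡ ∑[ a < k ] ∑[ b < l ] h a b
sum-remQuot k l h = trans (sum-combine k l _)
  (sum-cong-≗ λ a → sum-cong-≗ λ b → cong (uncurry h) (remQuot-combine a b))

sum-indicator : ∀ k (a : Fin k) → ∑[ j < k ] bit ⌊ a Fin.≟ j ⌋ ≡ 1
sum-indicator (suc k) zero    = cong suc (trans (sum-const k 0) (*-zeroʳ k))
sum-indicator (suc k) (suc a) = trans (sum-cong-≗ (suc-bit a)) (sum-indicator k a)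
  where
    suc-bit : ∀ {k} (a : Fin k) j → bit ⌊ Fin.suc a Fin.≟ suc j ⌋ ≡ bit ⌊ a Fin.≟ j ⌋
    suc-bit a j with a Fin.≟ j
    ... | yes _ = refl
    ... | no  _ = refl

Disjoint : ∀ {n} → Subset n → Subset n → Set
Disjoint A B = ∀ v → v ∈ A → v ∉ B

DisjointFamily : ∀ {n k} → (Fin k → Subset n) → Set
DisjointFamily {k = k} S = ∀ (i i′ : Fin k) → ¬ (i ≡ i′) → Disjoint (S i) (S i′)

disjoint-tail : ∀ {n} {a b} {A B : Subset n} → Disjoint (a ∷ A) (b ∷ B) → Disjoint A B
disjoint-tail d v p r = d (suc v) (there p) (there r)

⋃ᶠ : ∀ {n k} → (Fin k → Subset n) → Subset n
⋃ᶠ S = ⋃ (List.tabulate S)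

∣∷∣ : ∀ {n} b (p : Subset n) → ∣ b ∷ p ∣ ≡ bit b + ∣ p ∣
∣∷∣ true  p = refl
∣∷∣ false p = refl

∣∩∣-comm : ∀ {n} (X Y : Subset n) → ∣ X ∩ Y ∣ ≡ ∣ Y ∩ X ∣
∣∩∣-comm X Y = cong ∣_∣ (∩-comm X Y)

∣∩∁∣+∣∩∣ : ∀ {n} (X Y : Subset n) → ∣ X ∩ ∁ Y ∣ + ∣ X ∩ Y ∣ ≡ ∣ X ∣
∣∩∁∣+∣∩∣ []          []          = refl
∣∩∁∣+∣∩∣ (true  ∷ X) (true  ∷ Y) = trans (+-suc _ _) (cong suc (∣∩∁∣+∣∩∣ X Y))
∣∩∁∣+∣∩∣ (true  ∷ X) (false ∷ Y) = cong suc (∣∩∁∣+∣∩∣ X Y)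
∣∩∁∣+∣∩∣ (false ∷ X) (y     ∷ Y) = ∣∩∁∣+∣∩∣ X Y

∣∩∪∣ : ∀ {n} (X A B : Subset n) → Disjoint A B → ∣ X ∩ (A ∪ B) ∣ ≡ ∣ X ∩ A ∣ + ∣ X ∩ B ∣
∣∩∪∣ []          []          []          d = refl
∣∩∪∣ (x     ∷ X) (true  ∷ A) (true  ∷ B) d = ⊥-elim (d zero here here)
∣∩∪∣ (true  ∷ X) (true  ∷ A) (false ∷ B) d = cong suc (∣∩∪∣ X A B (disjoint-tail d))
∣∩∪∣ (true  ∷ X) (false ∷ A) (true  ∷ B) d = trans (cong suc (∣∩∪∣ X A B (disjoint-tail d))) (sym (+-suc _ _))
∣∩∪∣ (true  ∷ X) (false ∷ A) (false ∷ B) d = ∣∩∪∣ X A B (disjoint-tail d)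
∣∩∪∣ (false ∷ X) (true  ∷ A) (false ∷ B) d = ∣∩∪∣ X A B (disjoint-tail d)
∣∩∪∣ (false ∷ X) (false ∷ A) (b     ∷ B) d = ∣∩∪∣ X A B (disjoint-tail d)

∈⋃ᶠ : ∀ {n} k (S : Fin k → Subset n) v → v ∈ ⋃ᶠ S → Σ (Fin k) λ i → v ∈ S i
∈⋃ᶠ zero    S v p = ⊥-elim (∉⊥ p)
∈⋃ᶠ (suc k) S v p with x∈p∪q⁻ (S zero) (⋃ᶠ (S ∘ suc)) p
... | inj₁ q = zero , q
... | inj₂ q with ∈⋃ᶠ k (S ∘ suc) v q
...   | i , r = suc i , r

∣∩⋃ᶠ∣ : ∀ {n} k (S : Fin k → Subset n) → DisjointFamily S → (X : Subset n) →
  ∣ X ∩ ⋃ᶠ S ∣ ≡ ∑[ i < k ] ∣ X ∩ S i ∣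
∣∩⋃ᶠ∣ {n} zero    S d X = trans (cong ∣_∣ (∩-zeroʳ X)) (∣⊥∣≡0 n)
∣∩⋃ᶠ∣     (suc k) S d X =
  trans (∣∩∪∣ X (S zero) _ head-disjoint)
        (cong (∣ X ∩ S zero ∣ +_) (∣∩⋃ᶠ∣ k (S ∘ suc) tail-disjoint X))
  where
    tail-disjoint : DisjointFamily (S ∘ suc)
    tail-disjoint i i′ i≢i′ = d (suc i) (suc i′) (i≢i′ ∘ Fin-suc-injective)
    head-disjoint : Disjoint (S zero) (⋃ᶠ (S ∘ suc))
    head-disjoint v p q with ∈⋃ᶠ k (S ∘ suc) v q
    ... | i , r = d zero (suc i) (λ ()) v p r

cover-split : ∀ {n} k (S : Fin k → Subset n) → DisjointFamily S → (X : Subset n) →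
  ∣ X ∩ ∁ (⋃ᶠ S) ∣ + ∑[ i < k ] ∣ X ∩ S i ∣ ≡ ∣ X ∣
cover-split k S d X = trans (cong (∣ X ∩ ∁ (⋃ᶠ S) ∣ +_) (sym (∣∩⋃ᶠ∣ k S d X))) (∣∩∁∣+∣∩∣ X (⋃ᶠ S))

uncovered-from-traces : ∀ {n} k (S : Fin k → Subset n) → DisjointFamily S → (X : Subset n) →
  ∀ u → u + ∑[ i < k ] ∣ X ∩ S i ∣ ≡ ∣ X ∣ → ∣ X ∩ ∁ (⋃ᶠ S) ∣ ≡ u
uncovered-from-traces k S d X u eq = +-cancelʳ-≡ _ _ _ (trans (cover-split k S d X) (sym eq))

∑-part : ∀ {n m} (c : Fin n → Fin m) (Y : Subset n) → ∑[ j < m ] ∣ part c j ∩ Y ∣ ≡ ∣ Y ∣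
∑-part {zero}  {m} c []      = trans (sum-const m 0) (*-zeroʳ m)
∑-part {suc n} {m} c (y ∷ Y) = begin
    ∑[ j < m ] ∣ part c j ∩ (y ∷ Y) ∣
      ≡⟨ sum-cong-≗ (λ j → ∣∷∣ (⌊ c zero Fin.≟ j ⌋ ∧ y) (part (c ∘ suc) j ∩ Y)) ⟩
    ∑[ j < m ] (bit (⌊ c zero Fin.≟ j ⌋ ∧ y) + ∣ part (c ∘ suc) j ∩ Y ∣)
      ≡⟨ ∑-distrib-+ (λ j → bit (⌊ c zero Fin.≟ j ⌋ ∧ y)) (λ j → ∣ part (c ∘ suc) j ∩ Y ∣) ⟩
    ∑[ j < m ] bit (⌊ c zero Fin.≟ j ⌋ ∧ y) + ∑[ j < m ] ∣ part (c ∘ suc) j ∩ Y ∣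
      ≡⟨ cong₂ _+_ (head-count y) (∑-part (c ∘ suc) Y) ⟩
    bit y + ∣ Y ∣
      ≡⟨ sym (∣∷∣ y Y) ⟩
    ∣ y ∷ Y ∣ ∎
  where
    open ≡-Reasoning
    head-count : ∀ y → ∑[ j < m ] bit (⌊ c zero Fin.≟ j ⌋ ∧ y) ≡ bit y
    head-count true  = trans (sum-cong-≗ λ j → cong bit (∧-identityʳ ⌊ c zero Fin.≟ j ⌋)) (sum-indicator m (c zero))
    head-count false = trans (sum-cong-≗ λ j → cong bit (∧-zeroʳ ⌊ c zero Fin.≟ j ⌋)) (trans (sum-const m 0) (*-zeroʳ m))

record Solution (q : ℕ) .{{_ : NonZero q}} {n m : ℕ} (c : Fin n → Fin m) : Set where
  field
    class     : Fin q → Subset n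
    disjoint  : DisjointFamily class
    stable    : ∀ i → IsStable q (class i)
    uncovered : ∀ j → ∣ part c j ∩ ∁ (⋃ᶠ class) ∣ ≡ q ∸ 1
    balanced  : ∀ i i′ → ∣ class i ∣ ≤ suc ∣ class i′ ∣
    lower     : ∀ i j → ((∣ part c j ∣ + 1) / q) ∸ 1 ≤ ∣ class i ∩ part c j ∣

  part-size : ∀ j → (q ∸ 1) + ∑[ i < q ] ∣ part c j ∩ class i ∣ ≡ ∣ part c j ∣
  part-size j = trans (cong (_+ ∑[ i < q ] ∣ part c j ∩ class i ∣) (sym (uncovered j))) (cover-split q class disjoint (part c j))

  size : m * (q ∸ 1) + ∑[ i < q ] ∣ class i ∣ ≡ n
  size = begin
      m * (q ∸ 1) + ∑[ i < q ] ∣ class i ∣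
        ≡⟨ cong₂ _+_ (sym (sum-const m (q ∸ 1))) (sym (sum-cong-≗ λ i → ∑-part c (class i))) ⟩
      ∑[ j < m ] (q ∸ 1) + ∑[ i < q ] ∑[ j < m ] ∣ part c j ∩ class i ∣
        ≡⟨ cong (∑[ j < m ] (q ∸ 1) +_) (∑-comm (λ i j → ∣ part c j ∩ class i ∣)) ⟩
      ∑[ j < m ] (q ∸ 1) + ∑[ j < m ] ∑[ i < q ] ∣ part c j ∩ class i ∣
        ≡⟨ sym (∑-distrib-+ (λ _ → q ∸ 1) (λ j → ∑[ i < q ] ∣ part c j ∩ class i ∣)) ⟩
      ∑[ j < m ] ((q ∸ 1) + ∑[ i < q ] ∣ part c j ∩ class i ∣)
        ≡⟨ sum-cong-≗ part-size ⟩
      ∑[ j < m ] ∣ part c j ∣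
        ≡⟨ sum-cong-≗ (λ j → sym (cong ∣_∣ (∩-identityʳ (part c j)))) ⟩
      ∑[ j < m ] ∣ part c j ∩ ⊤ ∣
        ≡⟨ ∑-part c ⊤ ⟩
      ∣ ⊤ {n} ∣
        ≡⟨ ∣⊤∣≡n n ⟩
      n ∎
    where open ≡-Reasoning

SolutionΣ : (q : ℕ) .{{_ : NonZero q}} {n m : ℕ} (c : Fin n → Fin m) → Set
SolutionΣ q {n} c =
  Σ (Fin q → Subset n) λ S →
      DisjointFamily S × (∀ i → IsStable q (S i))
    × (∀ j → ∣ part c j ∩ ∁ (⋃ᶠ S) ∣ ≡ q ∸ 1)
    × (∀ i i′ → ∣ S i ∣ ≤ suc ∣ S i′ ∣)
    × (∀ i j → ((∣ part c j ∣ + 1) / q) ∸ 1 ≤ ∣ S i ∩ part c j ∣)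

fromΣ : ∀ {q} .{{_ : NonZero q}} {n m} {c : Fin n → Fin m} → SolutionΣ q c → Solution q c
fromΣ (S , d , s , u , b , l) = record
  { class = S ; disjoint = d ; stable = s ; uncovered = u ; balanced = b ; lower = l }

toΣ : ∀ {q} .{{_ : NonZero q}} {n m} {c : Fin n → Fin m} → Solution q c → SolutionΣ q c
toΣ s = class , disjoint , stable , uncovered , balanced , lower
  where open Solution s

-- The subpath spanned by T ⊆ Fin n: its vertices, listed from left to right,
-- are the vertices of the shorter path P_{|T|}, embedded back by emb T.
emb : ∀ {n} (T : Subset n) → Fin ∣ T ∣ → Fin n
emb (true  ∷ T) zero    = zero
emb (true  ∷ T) (suc a) = suc (emb T a)
emb (false ∷ T) a       = suc (emb T a)

emb∈ : ∀ {n} (T : Subset n) a → emb T a ∈ T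
emb∈ (true  ∷ T) zero    = here
emb∈ (true  ∷ T) (suc a) = there (emb∈ T a)
emb∈ (false ∷ T) a       = there (emb∈ T a)

restrict : ∀ {n} (T : Subset n) → Subset n → Subset ∣ T ∣
restrict []          []      = []
restrict (true  ∷ T) (x ∷ X) = x ∷ restrict T X
restrict (false ∷ T) (x ∷ X) = restrict T X

lift : ∀ {n} (T : Subset n) → Subset ∣ T ∣ → Subset n
lift []          []      = []
lift (true  ∷ T) (x ∷ R) = x ∷ lift T R
lift (false ∷ T) R       = false ∷ lift T R

restrict-tabulate : ∀ {n} (T : Subset n) (p : Fin n → Bool) →
  restrict T (tabulate p) ≡ tabulate (p ∘ emb T)
restrict-tabulate []          p = refl
restrict-tabulate (true  ∷ T) p = cong (p zero ∷_) (restrict-tabulate T (p ∘ suc))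
restrict-tabulate (false ∷ T) p = restrict-tabulate T (p ∘ suc)

part-emb : ∀ {n m} (T : Subset n) (c : Fin n → Fin m) j → part (c ∘ emb T) j ≡ restrict T (part c j)
part-emb T c j = sym (restrict-tabulate T (λ v → ⌊ c v Fin.≟ j ⌋))

∣restrict∣ : ∀ {n} (T X : Subset n) → ∣ restrict T X ∣ ≡ ∣ T ∩ X ∣
∣restrict∣ []          []          = refl
∣restrict∣ (true  ∷ T) (true  ∷ X) = cong suc (∣restrict∣ T X)
∣restrict∣ (true  ∷ T) (false ∷ X) = ∣restrict∣ T X
∣restrict∣ (false ∷ T) (x     ∷ X) = ∣restrict∣ T X

∣lift∣ : ∀ {n} (T : Subset n) R → ∣ lift T R ∣ ≡ ∣ R ∣
∣lift∣ []          []          = refl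
∣lift∣ (true  ∷ T) (true  ∷ R) = cong suc (∣lift∣ T R)
∣lift∣ (true  ∷ T) (false ∷ R) = ∣lift∣ T R
∣lift∣ (false ∷ T) R           = ∣lift∣ T R

∣lift∩∣ : ∀ {n} (T : Subset n) R X → ∣ lift T R ∩ X ∣ ≡ ∣ R ∩ restrict T X ∣
∣lift∩∣ []          []          []          = refl
∣lift∩∣ (true  ∷ T) (true  ∷ R) (true  ∷ X) = cong suc (∣lift∩∣ T R X)
∣lift∩∣ (true  ∷ T) (true  ∷ R) (false ∷ X) = ∣lift∩∣ T R X
∣lift∩∣ (true  ∷ T) (false ∷ R) (x     ∷ X) = ∣lift∩∣ T R X
∣lift∩∣ (false ∷ T) R           (x     ∷ X) = ∣lift∩∣ T R X

lift⁻ : ∀ {n} (T : Subset n) R v → v ∈ lift T R → Σ (Fin ∣ T ∣) λ a → emb T a ≡ v × a ∈ R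
lift⁻ (true  ∷ T) (true ∷ R) zero    here      = zero , refl , here
lift⁻ (true  ∷ T) (x ∷ R)    (suc v) (there p) with lift⁻ T R v p
... | a , refl , a∈R = suc a , refl , there a∈R
lift⁻ (false ∷ T) R          (suc v) (there p) with lift⁻ T R v p
... | a , refl , a∈R = a , refl , a∈R

lift⊆ : ∀ {n} (T : Subset n) R v → v ∈ lift T R → v ∈ T
lift⊆ T R v p with lift⁻ T R v p
... | a , refl , _ = emb∈ T a

lift-disjoint : ∀ {n} (T : Subset n) {A B} → Disjoint A B → Disjoint (lift T A) (lift T B)
lift-disjoint (true  ∷ T) {x ∷ A} {y ∷ B} d zero    here      here      = d zero here here
lift-disjoint (true  ∷ T) {x ∷ A} {y ∷ B} d (suc v) (there p) (there r) = lift-disjoint T (disjoint-tail d) v p r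
lift-disjoint (false ∷ T)                 d (suc v) (there p) (there r) = lift-disjoint T d v p r

stable-tail : ∀ {n} q x (T : Subset n) → IsStable q (x ∷ T) → IsStable q T
stable-tail q x T st u v p r u≢v = st (suc u) (suc v) (there p) (there r) (u≢v ∘ Fin-suc-injective)

first : ∀ {k} → Fin k → Fin k
first zero    = zero
first (suc _) = zero

toℕ-first : ∀ {k} (a : Fin k) → toℕ (first a) ≡ 0
toℕ-first zero    = refl
toℕ-first (suc _) = refl

-- Consecutive vertices of a q-stable set are at least q apart, hence its
-- a₂-th vertex lies at least q (a₂ - a₁) beyond its a₁-th vertex.
spread : ∀ {n} q (T : Subset n) → IsStable q T → (a₁ a₂ : Fin ∣ T ∣) → toℕ a₁ ≤ toℕ a₂ →
  q * (toℕ a₂ ∸ toℕ a₁) + toℕ (emb T a₁) ≤ toℕ (emb T a₂)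
spread q (true ∷ T) st zero zero _ rewrite *-zeroʳ q = z≤n
spread q (true ∷ T) st zero (suc a₂) _ = begin
    q * suc (toℕ a₂) + 0            ≡⟨ +-identityʳ _ ⟩
    q * suc (toℕ a₂)                ≡⟨ *-suc q (toℕ a₂) ⟩
    q + q * toℕ a₂                  ≤⟨ +-monoˡ-≤ _ first-gap ⟩
    suc (e₀ + q * toℕ a₂)           ≡⟨ cong suc (+-comm e₀ _) ⟩
    suc (q * toℕ a₂ + e₀)           ≤⟨ s≤s rest ⟩
    suc (toℕ (emb T a₂))            ∎
  where
    open ≤-Reasoning
    a₀ = first a₂
    e₀ = toℕ (emb T a₀)
    first-gap : q ≤ suc e₀
    first-gap = st zero (suc (emb T a₀)) here (there (emb∈ T a₀)) (λ ())
    rest : q * toℕ a₂ + e₀ ≤ toℕ (emb T a₂)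
    rest = subst (λ t → q * (toℕ a₂ ∸ t) + e₀ ≤ toℕ (emb T a₂)) (toℕ-first a₂)
      (spread q T (stable-tail q true T st) a₀ a₂ (subst (_≤ toℕ a₂) (sym (toℕ-first a₂)) z≤n))
spread q (true ∷ T) st (suc a₁) (suc a₂) (s≤s a₁≤a₂) =
  subst (_≤ suc (toℕ (emb T a₂))) (sym (+-suc _ _)) (s≤s (spread q T (stable-tail q true T st) a₁ a₂ a₁≤a₂))
spread q (false ∷ T) st a₁ a₂ a₁≤a₂ =
  subst (_≤ suc (toℕ (emb T a₂))) (sym (+-suc _ _)) (s≤s (spread q T (stable-tail q false T st) a₁ a₂ a₁≤a₂))

-- Two distinct vertices a₁ ≤ a₂ of a q₁-stable set R of the subpath of a
-- q₂-stable set T are mapped at distance ≥ q₁ q₂: the distance is at least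
-- q₂ (a₂ - a₁) by spread and a₂ - a₁ ≥ q₁.
lift-far : ∀ {n} q₁ q₂ (T : Subset n) R → IsStable q₂ T → IsStable q₁ R →
  ∀ a₁ a₂ → a₁ ∈ R → a₂ ∈ R → ¬ (a₁ ≡ a₂) → toℕ a₁ ≤ toℕ a₂ →
  q₁ * q₂ ≤ pathDist (emb T a₁) (emb T a₂)
lift-far q₁ q₂ T R stT stR a₁ a₂ a₁∈R a₂∈R a₁≢a₂ a₁≤a₂ = begin
    q₁ * q₂                                  ≡⟨ *-comm q₁ q₂ ⟩
    q₂ * q₁                                  ≤⟨ *-monoʳ-≤ q₂ q₁≤d ⟩
    q₂ * d                                   ≤⟨ m+n≤o⇒m≤o∸n (q₂ * d) gap ⟩
    toℕ (emb T a₂) ∸ toℕ (emb T a₁)          ≡⟨ sym (m≤n⇒∣m-n∣≡n∸m (m+n≤o⇒n≤o (q₂ * d) gap)) ⟩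
    pathDist (emb T a₁) (emb T a₂)           ∎
  where
    open ≤-Reasoning
    d = toℕ a₂ ∸ toℕ a₁
    q₁≤d : q₁ ≤ d
    q₁≤d = subst (q₁ ≤_) (m≤n⇒∣m-n∣≡n∸m a₁≤a₂) (stR a₁ a₂ a₁∈R a₂∈R a₁≢a₂)
    gap : q₂ * d + toℕ (emb T a₁) ≤ toℕ (emb T a₂)
    gap = spread q₂ T stT a₁ a₂ a₁≤a₂

lift-stable : ∀ {n} q₁ q₂ (T : Subset n) R → IsStable q₂ T → IsStable q₁ R → IsStable (q₁ * q₂) (lift T R)
lift-stable q₁ q₂ T R stT stR u v u∈ v∈ u≢v with lift⁻ T R u u∈ | lift⁻ T R v v∈
... | a₁ , refl , a₁∈R | a₂ , refl , a₂∈R with ≤-total (toℕ a₁) (toℕ a₂)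
... | inj₁ a₁≤a₂ = lift-far q₁ q₂ T R stT stR a₁ a₂ a₁∈R a₂∈R (u≢v ∘ cong (emb T)) a₁≤a₂
... | inj₂ a₂≤a₁ = subst (q₁ * q₂ ≤_) (∣-∣-comm (toℕ (emb T a₂)) _)
                     (lift-far q₁ q₂ T R stT stR a₂ a₁ a₂∈R a₁∈R (u≢v ∘ cong (emb T) ∘ sym) a₂≤a₁)

-- Two families whose values each differ by at most one, and whose sums
-- differ by at most one, differ by at most one from each other: otherwise
-- f a ≥ g a′ + 2 forces every f i ≥ g a′ + 1 ≥ g i and so ∑ f ≥ ∑ g + 2.
balance : ∀ {k} (f g : Fin k → ℕ) → (∀ a a′ → f a ≤ suc (f a′)) → (∀ a a′ → g a ≤ suc (g a′)) →
  sum f ≤ suc (sum g) → ∀ a a′ → f a ≤ suc (g a′)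
balance {suc k} f g f-near g-near sum-near a a′ with f a ≤? suc (g a′)
... | yes fa≤ = fa≤
... | no  fa≰ = ⊥-elim (n≮n _ impossible)
  where
    open ≤-Reasoning
    L = g a′
    M = k * suc L
    big : suc (suc L) ≤ f a
    big = ≰⇒> fa≰
    f-rest : M ≤ sum (f ∘ punchIn a)
    f-rest = subst (_≤ sum (f ∘ punchIn a)) (sum-const k (suc L))
      (sum-mono λ i → s≤s⁻¹ (≤-trans big (f-near a (punchIn a i))))
    g-rest : sum (g ∘ punchIn a′) ≤ M
    g-rest = subst (sum (g ∘ punchIn a′) ≤_) (sum-const k (suc L)) (sum-mono λ i → g-near (punchIn a′ i) a′)
    impossible : suc (suc (L + M)) ≤ suc (L + M)
    impossible = begin
      suc (suc L) + M                      ≤⟨ +-mono-≤ big f-rest ⟩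
      f a + sum (f ∘ punchIn a)            ≡⟨ sum-remove f ⟨
      sum f                                ≤⟨ sum-near ⟩
      suc (sum g)                          ≡⟨ cong suc (sum-remove g) ⟩
      suc (L + sum (g ∘ punchIn a′))       ≤⟨ s≤s (+-monoʳ-≤ L g-rest) ⟩
      suc (L + M)                          ∎

remQuot-injective : ∀ {k} l {i i′ : Fin (k * l)} → remQuot {k} l i ≡ remQuot l i′ → i ≡ i′
remQuot-injective {k} l {i} {i′} eq = begin
    i                                     ≡⟨ combine-remQuot {k} l i ⟨
    uncurry combine (remQuot {k} l i)     ≡⟨ cong (uncurry (combine {k})) eq ⟩
    uncurry combine (remQuot {k} l i′)    ≡⟨ combine-remQuot {k} l i′ ⟩
    i′                                    ∎
  where open ≡-Reasoning

pred≤⇒≤+1 : ∀ a b → a ∸ 1 ≤ b → a ≤ b + 1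
pred≤⇒≤+1 zero    b _   = z≤n
pred≤⇒≤+1 (suc a) b a≤b = subst (suc a ≤_) (+-comm 1 b) (s≤s a≤b)

-- A part large enough for P(q₁ q₂) is large enough, after one round of
-- P(q₂), for P(q₁): (v + 1) / q₂ - 1 ≥ q₁ - 1 when v + 1 ≥ q₁ q₂.
quotient-large : ∀ q₁ q₂ v .{{_ : NonZero q₂}} → q₁ * q₂ ≤ v + 1 → q₁ ∸ 1 ≤ (v + 1) / q₂ ∸ 1
quotient-large q₁ q₂ v le =
  ∸-monoˡ-≤ 1 (subst (_≤ (v + 1) / q₂) (m*n/n≡m q₁ q₂) (/-monoˡ-≤ q₂ le))

quotient-compose : ∀ q₁ q₂ v w .{{_ : NonZero q₁}} .{{_ : NonZero q₂}} .{{_ : NonZero (q₁ * q₂)}} →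
  (v + 1) / q₂ ∸ 1 ≤ w → (v + 1) / (q₁ * q₂) ≤ (w + 1) / q₁
quotient-compose q₁ q₂ v w le = begin
    (v + 1) / (q₁ * q₂)   ≡⟨ /-congʳ (*-comm q₁ q₂) ⟩
    (v + 1) / (q₂ * q₁)   ≡⟨ m/n/o≡m/[n*o] (v + 1) q₂ q₁ ⟨
    (v + 1) / q₂ / q₁     ≤⟨ /-monoˡ-≤ q₁ (pred≤⇒≤+1 ((v + 1) / q₂) w le) ⟩
    (w + 1) / q₁          ∎
  where
    open ≤-Reasoning
    instance
      q₂*q₁≢0 : NonZero (q₂ * q₁)
      q₂*q₁≢0 = m*n≢0 q₂ q₁

-- The q₁ q₂ - 1 uncovered vertices of a part: q₂ - 1 outside the outer
-- classes and q₁ - 1 inside each of the q₂ outer classes.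
pred-product : ∀ q₁ q₂ .{{_ : NonZero q₁}} .{{_ : NonZero q₂}} →
  (q₂ ∸ 1) + q₂ * (q₁ ∸ 1) ≡ q₁ * q₂ ∸ 1
pred-product (suc x) (suc y) = cong (y +_) (*-comm (suc y) x)

∣part-emb∣ : ∀ {n m} (T : Subset n) (c : Fin n → Fin m) j → ∣ part (c ∘ emb T) j ∣ ≡ ∣ T ∩ part c j ∣
∣part-emb∣ T c j = trans (cong ∣_∣ (part-emb T c j)) (∣restrict∣ T (part c j))

subpath-large : ∀ q₁ q₂ .{{_ : NonZero q₂}} {n m} {c : Fin n → Fin m} (outer : Solution q₂ c) →
  (∀ j → q₁ * q₂ ∸ 1 ≤ ∣ part c j ∣) →
  ∀ b j → q₁ ∸ 1 ≤ ∣ part (c ∘ emb (Solution.class outer b)) j ∣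
subpath-large q₁ q₂ {c = c} outer large b j = begin
    q₁ ∸ 1                                ≤⟨ quotient-large q₁ q₂ _ (pred≤⇒≤+1 (q₁ * q₂) _ (large j)) ⟩
    (∣ part c j ∣ + 1) / q₂ ∸ 1           ≤⟨ Solution.lower outer b j ⟩
    ∣ T ∩ part c j ∣                      ≡⟨ ∣part-emb∣ T c j ⟨
    ∣ part (c ∘ emb T) j ∣                ∎
  where
    open ≤-Reasoning
    T = Solution.class outer b

module Composition (q₁ q₂ : ℕ) .{{_ : NonZero q₁}} .{{_ : NonZero q₂}} {n m : ℕ}
  (c : Fin n → Fin m) (outer : Solution q₂ c)
  (inner : (b : Fin q₂) → Solution q₁ (c ∘ emb (Solution.class outer b)))
  where

  instance
    q₁*q₂≢0 : NonZero (q₁ * q₂)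
    q₁*q₂≢0 = m*n≢0 q₁ q₂

  open Solution outer using () renaming (class to T)
  module R (b : Fin q₂) = Solution (inner b)

  V : Fin m → Subset n
  V = part c

  W : (b : Fin q₂) → Fin m → Subset ∣ T b ∣
  W b = part (c ∘ emb (T b))

  S′ : Fin q₁ → Fin q₂ → Subset n
  S′ a b = lift (T b) (R.class b a)

  pair : Fin (q₁ * q₂) → Fin q₁ × Fin q₂
  pair = remQuot {q₁} q₂

  S : Fin (q₁ * q₂) → Subset n
  S i = uncurry S′ (pair i)

  S′∩V : ∀ a b j → ∣ S′ a b ∩ V j ∣ ≡ ∣ R.class b a ∩ W b j ∣
  S′∩V a b j = trans (∣lift∩∣ (T b) (R.class b a) (V j)) (cong (λ Z → ∣ R.class b a ∩ Z ∣) (sym (part-emb (T b) c j)))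

  disjoint′ : ∀ a b a′ b′ → ¬ ((a , b) ≡ (a′ , b′)) → Disjoint (S′ a b) (S′ a′ b′)
  disjoint′ a b a′ b′ ≢ v p r with b Fin.≟ b′
  ... | no b≢b′ = Solution.disjoint outer b b′ b≢b′ v (lift⊆ (T b) _ v p) (lift⊆ (T b′) _ v r)
  ... | yes refl with a Fin.≟ a′
  ...   | yes refl = ≢ refl
  ...   | no a≢a′  = lift-disjoint (T b) (R.disjoint b a a′ a≢a′) v p r

  disjoint : DisjointFamily S
  disjoint i i′ i≢i′ = disjoint′ _ _ _ _ (i≢i′ ∘ remQuot-injective {q₁} q₂)

  stable : ∀ i → IsStable (q₁ * q₂) (S i)
  stable i = lift-stable q₁ q₂ (T b) (R.class b a) (Solution.stable outer b) (R.stable b a)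
    where
      a = proj₁ (pair i)
      b = proj₂ (pair i)

  -- The inner classes of T b have total size |T b| - m (q₁ - 1), so the
  -- near-equal sizes of the T b give near-equal totals.
  totals-near : ∀ b b′ → ∑[ a < q₁ ] ∣ R.class b a ∣ ≤ suc (∑[ a < q₁ ] ∣ R.class b′ a ∣)
  totals-near b b′ = +-cancelˡ-≤ (m * (q₁ ∸ 1)) _ _ (begin
      m * (q₁ ∸ 1) + ∑[ a < q₁ ] ∣ R.class b a ∣          ≡⟨ R.size b ⟩
      ∣ T b ∣                                              ≤⟨ Solution.balanced outer b b′ ⟩
      suc ∣ T b′ ∣                                         ≡⟨ cong suc (R.size b′) ⟨
      suc (m * (q₁ ∸ 1) + ∑[ a < q₁ ] ∣ R.class b′ a ∣)    ≡⟨ +-suc _ _ ⟨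
      m * (q₁ ∸ 1) + suc (∑[ a < q₁ ] ∣ R.class b′ a ∣)    ∎)
    where open ≤-Reasoning

  balanced : ∀ i i′ → ∣ S i ∣ ≤ suc ∣ S i′ ∣
  balanced i i′ = subst₂ (λ s s′ → s ≤ suc s′) (sym (∣lift∣ (T b) _)) (sym (∣lift∣ (T b′) _))
    (balance (λ a → ∣ R.class b a ∣) (λ a → ∣ R.class b′ a ∣) (R.balanced b) (R.balanced b′) (totals-near b b′) a a′)
    where
      a  = proj₁ (pair i)
      b  = proj₂ (pair i)
      a′ = proj₁ (pair i′)
      b′ = proj₂ (pair i′)

  lower : ∀ i j → ((∣ V j ∣ + 1) / (q₁ * q₂)) ∸ 1 ≤ ∣ S i ∩ V j ∣
  lower i j = begin
      (∣ V j ∣ + 1) / (q₁ * q₂) ∸ 1        ≤⟨ ∸-monoˡ-≤ 1 (quotient-compose q₁ q₂ _ _ outer-lower) ⟩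
      (∣ W b j ∣ + 1) / q₁ ∸ 1             ≤⟨ R.lower b a j ⟩
      ∣ R.class b a ∩ W b j ∣              ≡⟨ S′∩V a b j ⟨
      ∣ S′ a b ∩ V j ∣                     ∎
    where
      open ≤-Reasoning
      a = proj₁ (pair i)
      b = proj₂ (pair i)
      outer-lower : (∣ V j ∣ + 1) / q₂ ∸ 1 ≤ ∣ W b j ∣
      outer-lower = subst (_ ≤_) (sym (∣part-emb∣ (T b) c j)) (Solution.lower outer b j)

  inner-part-size : ∀ b j → (q₁ ∸ 1) + ∑[ a < q₁ ] ∣ V j ∩ S′ a b ∣ ≡ ∣ V j ∩ T b ∣
  inner-part-size b j = begin
      (q₁ ∸ 1) + ∑[ a < q₁ ] ∣ V j ∩ S′ a b ∣
        ≡⟨ cong ((q₁ ∸ 1) +_) (sum-cong-≗ λ a → trans (∣∩∣-comm (V j) (S′ a b)) (trans (S′∩V a b j) (∣∩∣-comm _ (W b j)))) ⟩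
      (q₁ ∸ 1) + ∑[ a < q₁ ] ∣ W b j ∩ R.class b a ∣
        ≡⟨ R.part-size b j ⟩
      ∣ W b j ∣
        ≡⟨ trans (∣part-emb∣ (T b) c j) (∣∩∣-comm (T b) (V j)) ⟩
      ∣ V j ∩ T b ∣ ∎
    where open ≡-Reasoning

  part-size : ∀ j → (q₁ * q₂ ∸ 1) + ∑[ i < q₁ * q₂ ] ∣ V j ∩ S i ∣ ≡ ∣ V j ∣
  part-size j = begin
      (q₁ * q₂ ∸ 1) + ∑[ i < q₁ * q₂ ] ∣ V j ∩ S i ∣
        ≡⟨ cong₂ _+_ (sym (pred-product q₁ q₂)) (sum-remQuot q₁ q₂ (λ a b → ∣ V j ∩ S′ a b ∣)) ⟩
      ((q₂ ∸ 1) + q₂ * (q₁ ∸ 1)) + ∑[ a < q₁ ] ∑[ b < q₂ ] ∣ V j ∩ S′ a b ∣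
        ≡⟨ cong (((q₂ ∸ 1) + q₂ * (q₁ ∸ 1)) +_) (∑-comm (λ a b → ∣ V j ∩ S′ a b ∣)) ⟩
      ((q₂ ∸ 1) + q₂ * (q₁ ∸ 1)) + ∑[ b < q₂ ] ∑[ a < q₁ ] ∣ V j ∩ S′ a b ∣
        ≡⟨ +-assoc (q₂ ∸ 1) _ _ ⟩
      (q₂ ∸ 1) + (q₂ * (q₁ ∸ 1) + ∑[ b < q₂ ] ∑[ a < q₁ ] ∣ V j ∩ S′ a b ∣)
        ≡⟨ cong ((q₂ ∸ 1) +_) (cong (_+ ∑[ b < q₂ ] ∑[ a < q₁ ] ∣ V j ∩ S′ a b ∣) (sym (sum-const q₂ (q₁ ∸ 1)))) ⟩
      (q₂ ∸ 1) + (∑[ b < q₂ ] (q₁ ∸ 1) + ∑[ b < q₂ ] ∑[ a < q₁ ] ∣ V j ∩ S′ a b ∣)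
        ≡⟨ cong ((q₂ ∸ 1) +_) (sym (∑-distrib-+ (λ _ → q₁ ∸ 1) (λ b → ∑[ a < q₁ ] ∣ V j ∩ S′ a b ∣))) ⟩
      (q₂ ∸ 1) + ∑[ b < q₂ ] ((q₁ ∸ 1) + ∑[ a < q₁ ] ∣ V j ∩ S′ a b ∣)
        ≡⟨ cong ((q₂ ∸ 1) +_) (sum-cong-≗ λ b → inner-part-size b j) ⟩
      (q₂ ∸ 1) + ∑[ b < q₂ ] ∣ V j ∩ T b ∣
        ≡⟨ Solution.part-size outer j ⟩
      ∣ V j ∣ ∎
    where open ≡-Reasoning

  composed : Solution (q₁ * q₂) c
  composed = record
    { class     = S
    ; disjoint  = disjoint
    ; stable    = stable
    ; uncovered = λ j → uncovered-from-traces (q₁ * q₂) S disjoint (V j) _ (part-size j)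
    ; balanced  = balanced
    ; lower     = lower
    }

proposition1 : (q′ q″ : ℕ) → .{{_ : NonZero q′}} → .{{_ : NonZero q″}} →
    Prop q′ → Prop q″ → Prop (q′ * q″) {{m*n≢0 q′ q″}}
proposition1 q′ q″ P′ P″ n m c large = toΣ {{m*n≢0 q′ q″}} (Composition.composed q′ q″ c outer inner)
  where
    outer-large : ∀ j → q″ ∸ 1 ≤ ∣ part c j ∣
    outer-large j = ≤-trans (∸-monoˡ-≤ 1 (m≤n*m q″ q′)) (large j)
    outer : Solution q″ c
    outer = fromΣ (P″ n m c outer-large)
    inner : (b : Fin q″) → Solution q′ (c ∘ emb (Solution.class outer b))
    inner b = fromΣ (P′ _ m _ (subpath-large q′ q″ outer large b))
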